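{- Let $\Gamma$ be a finite, simple, connected bipartite graph of diameter $3$ with bipartition sets $X$ and $Y$. Then $\Gamma$ is $1$-distance-balanced if and only if either $\Gamma$ is regular, or $\Gamma$ is biregular with $|N(u)| = |Y|/2$ and $|N(v)| = |X|/2$ for every $u \in X$ and $v \in Y$.
   Context: $N(u)$ denotes the set of neighbours of $u$. A graph is biregular if its vertices have exactly two different degrees. For vertices $u,v$, $W_{uv} = \{w \mid d(u,w) < d(v,w)\}$. A connected graph is $1$-distance-balanced if $|W_{uv}| = |W_{vu}|$ for every pair of adjacent vertices $u,v$. -}

module Defs where

open import Data.Nat using (ℕ; zero; suc; _+_; _*_; _≤_; _<ᵇ_)
open import Data.Bool using (Bool; true; false; if_then_else_; _∧_)
open import Data.Fin using (Fin)
open import Data.Fin.Properties using (_≟_)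
open import Data.List using (List; length; filter)
open import Data.Bool.ListAction using (any)
open import Data.List.Base using (allFin)
open import Data.Product using (Σ; _×_; ∃; ∃-syntax)
open import Data.Sum using (_⊎_)
open import Relation.Nullary using (¬_)
open import Relation.Nullary.Decidable using (⌊_⌋)
open import Relation.Binary.PropositionalEquality using (_≡_; _≢_)

record Graph (n : ℕ) : Set where
  field
    adj      : Fin n → Fin n → Bool
    adj-sym  : ∀ u v → adj u v ≡ adj v u
    adj-irr  : ∀ u → adj u u ≡ false

module _ {n : ℕ} (G : Graph n) where
  open Graph G

  count : (Fin n → Bool) → ℕ
  count P = length (filter (λ w → P w ≡? true) (allFin n))
    where
      open import Data.Bool.Properties using () renaming (_≟_ to _≡?_)

  deg : Fin n → ℕ
  deg u = count (adj u)

  walk : ℕ → Fin n → Fin n → Bool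
  walk zero    u w = ⌊ u ≟ w ⌋
  walk (suc k) u w = any (λ x → adj u x ∧ walk k x w) (allFin n)

  search : (ℕ → Bool) → ℕ → ℕ → ℕ
  search f i zero       = i
  search f i (suc fuel) = if f i then i else search f (suc i) fuel

  -- A shortest walk in a
  -- graph on n vertices has length < n, so searching k < n suffices
  -- (value n is only returned for unreachable pairs, which do not occur
  -- in connected graphs).
  dist : Fin n → Fin n → ℕ
  dist u w = search (λ k → walk k u w) 0 n

  Connected : Set
  Connected = ∀ u w → ∃[ k ] (walk k u w ≡ true)

  HasDiameter : ℕ → Set
  HasDiameter D = (∀ u w → dist u w ≤ D) × (∃[ u ] ∃[ w ] (dist u w ≡ D))

  -- side u = true means u ∈ X, side u = false means u ∈ Y;
  -- every edge joins X and Y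
  IsBipartition : (Fin n → Bool) → Set
  IsBipartition side = ∀ u v → adj u v ≡ true → side u ≢ side v

  sizeW : Fin n → Fin n → ℕ
  sizeW u v = count (λ w → dist u w <ᵇ dist v w)

  OneDistanceBalanced : Set
  OneDistanceBalanced =
    Connected × (∀ u v → adj u v ≡ true → sizeW u v ≡ sizeW v u)

  Regular : Set
  Regular = ∃[ k ] (∀ u → deg u ≡ k)

  Biregular : Set
  Biregular = ∃[ a ] ∃[ b ] (a ≢ b × (∀ u → deg u ≡ a ⊎ deg u ≡ b)
                            × (∃[ u ] deg u ≡ a) × (∃[ u ] deg u ≡ b))

-- For an edge ab of a bipartite graph every vertex w has d(b,w) = d(a,w) ± 1, and when all
-- distances are at most 3 a layer-by-layer count gives |W_ab| + |N(b)| = |N(a)| + |C(a)|,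
-- where C(a) is the side containing a.  So ab is balanced iff the potential 2|N(a)| + |C(a)|
-- agrees at a and b, and by connectivity the graph is 1-distance-balanced iff the potential is
-- constant.  That means degree A on X and B on Y with 2A + |X| = 2B + |Y|; together with the
-- handshake identity |X| A = |Y| B this gives (|X| - 2B)(A - B) = 0, i.e. A = B or
-- 2A = |Y| and 2B = |X|.

module Submission where

open import Defs
open import Data.Bool using (Bool; true; false; not)
open import Data.Bool.Properties using (T-≡; T-∧; not-¬; ¬-not; not-injective) renaming (_≟_ to _≟ᵇ_)
open import Data.Fin using (Fin; zero; suc; toℕ)
open import Data.Fin.Properties using (_≟_; toℕ≤pred[n]; pigeonhole)
open import Data.List using (_∷_; []; length; filter; tabulate; allFin)
open import Data.List.Membership.Propositional using (lose)
open import Data.List.Membership.Propositional.Properties using (∈-allFin)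
open import Data.List.Relation.Unary.Any using (satisfied)
open import Data.List.Relation.Unary.Any.Properties using (any⁺; any⁻)
open import Data.Nat
  using (ℕ; zero; suc; _+_; _*_; _∸_; _≤_; _<_; _<?_; _≡ᵇ_; _<ᵇ_; z≤n; s≤s; NonZero; >-nonZero)
  renaming (_≟_ to _≟ℕ_)
open import Data.Nat.Induction using (<-rec)
open import Data.Nat.Properties
  using ( +-*-semiring; +-comm; +-identityʳ; +-suc; *-zeroʳ; +-cancelʳ-≡; *-cancelˡ-≡; *-cancelʳ-≡
        ; ≤-reflexive; ≤-trans; ≤-antisym; <-≤-trans; <-cmp; ≮⇒≥; <⇒≱; <⇒≢; n<1+n; m≤m+n; m≤n+m
        ; m≤n⇒m<n∨m≡n; m≤n⇒∃[o]m+o≡n; m+[n∸m]≡n; +-monoˡ-<)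
open import Data.Nat.Tactic.RingSolver using (solve)
open import Data.Product using (_×_; _,_; ∃-syntax; proj₁; proj₂)
open import Data.Sum using (_⊎_; inj₁; inj₂; [_,_]′)
open import Function using (_∘_; id; _⇔_; mk⇔; Equivalence)
open import Function.Construct.Composition using (_⇔-∘_)
open import Relation.Binary.Definitions using (tri<; tri≈; tri>)
open import Relation.Binary.PropositionalEquality
  using (_≡_; _≢_; refl; sym; trans; cong; cong₂; subst; module ≡-Reasoning)
open import Relation.Nullary using (yes; no; contradiction)
open import Relation.Nullary.Decidable using (⌊_⌋; isYes≗does; dec-true)
import Algebra.Properties.Semiring.Sum as Sum

open Sum +-*-semiring
  using (sum-cong-≗; sum-syntax; ∑-distrib-+; ∑-comm; *-distribˡ-sum; *-distribʳ-sum; sum-replicate-zero)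

𝟙 : Bool → ℕ
𝟙 true  = 1
𝟙 false = 0

private
  bool-cases : ∀ {A : Set} b → (b ≡ true → A) → (b ≡ false → A) → A
  bool-cases true  onTrue onFalse = onTrue refl
  bool-cases false onTrue onFalse = onFalse refl

module _ {n : ℕ} (G : Graph n) where
  open Graph G
  open Equivalence
  open ≡-Reasoning

  private
    length-filter-tabulate : ∀ {A : Set} {m} (g : Fin m → A) (P : A → Bool) →
      length (filter (λ x → P x ≟ᵇ true) (tabulate g)) ≡ ∑[ i < m ] 𝟙 (P (g i))
    length-filter-tabulate {m = zero}  g P = refl
    length-filter-tabulate {m = suc m} g P with P (g zero)
    ... | true  = cong suc (length-filter-tabulate (g ∘ suc) P)
    ... | false = length-filter-tabulate (g ∘ suc) P

  count≡∑ : (P : Fin n → Bool) → count G P ≡ ∑[ w < n ] 𝟙 (P w)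
  count≡∑ P = length-filter-tabulate id P

  count-cong : ∀ {P Q : Fin n → Bool} → (∀ w → P w ≡ Q w) → count G P ≡ count G Q
  count-cong {P} {Q} P≗Q = begin
    count G P           ≡⟨ count≡∑ P ⟩
    ∑[ w < n ] 𝟙 (P w)  ≡⟨ sum-cong-≗ (cong 𝟙 ∘ P≗Q) ⟩
    ∑[ w < n ] 𝟙 (Q w)  ≡⟨ count≡∑ Q ⟨
    count G Q           ∎

  count₃-cong : ∀ {P Q R P′ Q′ R′ : Fin n → Bool} →
    (∀ w → 𝟙 (P w) + 𝟙 (Q w) + 𝟙 (R w) ≡ 𝟙 (P′ w) + 𝟙 (Q′ w) + 𝟙 (R′ w)) →
    count G P + count G Q + count G R ≡ count G P′ + count G Q′ + count G R′
  count₃-cong {P} {Q} {R} {P′} {Q′} {R′} pointwise = begin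
    count G P + count G Q + count G R
      ≡⟨ cong₂ _+_ (cong₂ _+_ (count≡∑ P) (count≡∑ Q)) (count≡∑ R) ⟩
    ∑[ w < n ] 𝟙 (P w) + ∑[ w < n ] 𝟙 (Q w) + ∑[ w < n ] 𝟙 (R w)
      ≡⟨ ∑₃ P Q R ⟨
    ∑[ w < n ] (𝟙 (P w) + 𝟙 (Q w) + 𝟙 (R w))
      ≡⟨ sum-cong-≗ pointwise ⟩
    ∑[ w < n ] (𝟙 (P′ w) + 𝟙 (Q′ w) + 𝟙 (R′ w))
      ≡⟨ ∑₃ P′ Q′ R′ ⟩
    ∑[ w < n ] 𝟙 (P′ w) + ∑[ w < n ] 𝟙 (Q′ w) + ∑[ w < n ] 𝟙 (R′ w)
      ≡⟨ cong₂ _+_ (cong₂ _+_ (count≡∑ P′) (count≡∑ Q′)) (count≡∑ R′) ⟨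
    count G P′ + count G Q′ + count G R′ ∎
    where
    ∑₃ : ∀ P Q R → ∑[ w < n ] (𝟙 (P w) + 𝟙 (Q w) + 𝟙 (R w)) ≡
                   ∑[ w < n ] 𝟙 (P w) + ∑[ w < n ] 𝟙 (Q w) + ∑[ w < n ] 𝟙 (R w)
    ∑₃ P Q R = trans (∑-distrib-+ (λ w → 𝟙 (P w) + 𝟙 (Q w)) (λ w → 𝟙 (R w)))
                     (cong (_+ ∑[ w < n ] 𝟙 (R w)) (∑-distrib-+ (λ w → 𝟙 (P w)) (λ w → 𝟙 (Q w))))

  count-singleton : ∀ a → count G (λ w → ⌊ w ≟ a ⌋) ≡ 1
  count-singleton a = trans (count≡∑ (λ w → ⌊ w ≟ a ⌋)) (∑-𝟙-≟ a)
    where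
    ∑-𝟙-≟ : ∀ {m} (a : Fin m) → ∑[ w < m ] 𝟙 ⌊ w ≟ a ⌋ ≡ 1
    ∑-𝟙-≟ {suc m} zero    = cong suc (sum-replicate-zero m)
    ∑-𝟙-≟ {suc m} (suc a) = trans (sum-cong-≗ (λ w → cong 𝟙 (≟-suc w))) (∑-𝟙-≟ a)
      where
      ≟-suc : ∀ w → ⌊ suc w ≟ suc a ⌋ ≡ ⌊ w ≟ a ⌋
      ≟-suc w = trans (isYes≗does (suc w ≟ suc a)) (sym (isYes≗does (w ≟ a)))

  ∑-𝟙*-constant : ∀ {P : Fin n → Bool} {f : Fin n → ℕ} {c} → (∀ u → P u ≡ true → f u ≡ c) →
    ∑[ u < n ] (𝟙 (P u) * f u) ≡ count G P * c
  ∑-𝟙*-constant {P} {f} {c} f≡c = begin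
    ∑[ u < n ] (𝟙 (P u) * f u)  ≡⟨ sum-cong-≗ on-P ⟩
    ∑[ u < n ] (𝟙 (P u) * c)    ≡⟨ *-distribʳ-sum c (λ u → 𝟙 (P u)) ⟨
    ∑[ u < n ] 𝟙 (P u) * c      ≡⟨ cong (_* c) (count≡∑ P) ⟨
    count G P * c               ∎
    where
    on-P : ∀ u → 𝟙 (P u) * f u ≡ 𝟙 (P u) * c
    on-P u with P u in Pu
    ... | true  = cong (_+ 0) (f≡c u Pu)
    ... | false = refl

  count-positive : ∀ {P : Fin n → Bool} v → P v ≡ true → 1 ≤ count G P
  count-positive {P} v Pv rewrite count≡∑ P =
    subst (λ b → 𝟙 b ≤ ∑[ w < n ] 𝟙 (P w)) Pv (∑-≥-term (λ w → 𝟙 (P w)) v)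
    where
    ∑-≥-term : ∀ {m} (f : Fin m → ℕ) i → f i ≤ ∑[ w < m ] f w
    ∑-≥-term f zero    = m≤m+n (f zero) _
    ∑-≥-term f (suc i) = ≤-trans (∑-≥-term (f ∘ suc) i) (m≤n+m _ (f zero))

  walk-refl : ∀ u → walk G 0 u u ≡ true
  walk-refl u = trans (isYes≗does (u ≟ u)) (dec-true (u ≟ u) refl)

  walk-zero⇒≡ : ∀ {u w} → walk G 0 u w ≡ true → u ≡ w
  walk-zero⇒≡ {u} {w} h with u ≟ w
  ... | yes u≡w = u≡w

  walk-∷ : ∀ k {u x w} → adj u x ≡ true → walk G k x w ≡ true → walk G (suc k) u w ≡ true
  walk-∷ k {x = x} ux xw =
    to T-≡ (any⁺ _ (lose (∈-allFin x) (from T-∧ (from T-≡ ux , from T-≡ xw))))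

  walk-uncons : ∀ k {u w} → walk G (suc k) u w ≡ true → ∃[ x ] adj u x ≡ true × walk G k x w ≡ true
  walk-uncons k h with satisfied (any⁻ _ (allFin n) (from T-≡ h))
  ... | x , t with to T-∧ t
  ...   | ux , xw = x , to T-≡ ux , to T-≡ xw

  walk-++ : ∀ i j {u x w} → walk G i u x ≡ true → walk G j x w ≡ true → walk G (i + j) u w ≡ true
  walk-++ zero    j ux xw rewrite walk-zero⇒≡ ux = xw
  walk-++ (suc i) j ux xw with walk-uncons i ux
  ... | y , uy , yx = walk-∷ (i + j) uy (walk-++ i j yx xw)

  walk-split : ∀ i j {u w} → walk G (i + j) u w ≡ true →
    ∃[ x ] walk G i u x ≡ true × walk G j x w ≡ true
  walk-split zero    j {u = u} uw = u , walk-refl u , uw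
  walk-split (suc i) j uw with walk-uncons (i + j) uw
  ... | y , uy , yw with walk-split i j yw
  ...   | x , yx , xw = x , walk-∷ i uy yx , xw

  private
    split-at : ∀ {k u w} → walk G k u w ≡ true → n ≤ k → (i : Fin (suc n)) →
      ∃[ x ] walk G (toℕ i) u x ≡ true × walk G (k ∸ toℕ i) x w ≡ true
    split-at {k} {u} {w} uw n≤k i = walk-split (toℕ i) (k ∸ toℕ i)
      (subst (λ m → walk G m u w ≡ true) (sym (m+[n∸m]≡n (≤-trans (toℕ≤pred[n] i) n≤k))) uw)

  -- Two of the first n + 1 vertices of a walk of length k ≥ n coincide; cut out the closed walk between them.
  walk-shorten : ∀ {k u w} → walk G k u w ≡ true → n ≤ k → ∃[ j ] j < k × walk G j u w ≡ true
  walk-shorten {k} {u} {w} uw n≤k with pigeonhole (n<1+n n) (proj₁ ∘ split-at uw n≤k)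
  ... | i , j , i<j , xᵢ≡xⱼ =
    toℕ i + (k ∸ toℕ j) , shorter , walk-++ (toℕ i) (k ∸ toℕ j) uxᵢ xᵢw
    where
    uxᵢ = proj₁ (proj₂ (split-at uw n≤k i))
    xᵢw = subst (λ x → walk G (k ∸ toℕ j) x w ≡ true) (sym xᵢ≡xⱼ) (proj₂ (proj₂ (split-at uw n≤k j)))
    shorter : toℕ i + (k ∸ toℕ j) < k
    shorter = <-≤-trans (+-monoˡ-< (k ∸ toℕ j) i<j)
      (≤-reflexive (m+[n∸m]≡n (≤-trans (toℕ≤pred[n] j) n≤k)))

  walk-<n : ∀ k {u w} → walk G k u w ≡ true → ∃[ j ] j < n × walk G j u w ≡ true
  walk-<n k {u} {w} = <-rec (λ k → walk G k u w ≡ true → ∃[ j ] j < n × walk G j u w ≡ true) shortest k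
    where
    shortest : ∀ k → (∀ {j} → j < k → walk G j u w ≡ true → ∃[ j ] j < n × walk G j u w ≡ true) →
      walk G k u w ≡ true → ∃[ j ] j < n × walk G j u w ≡ true
    shortest k rec uw with k <? n
    ... | yes k<n = k , k<n , uw
    ... | no  k≮n with walk-shorten uw (≮⇒≥ k≮n)
    ...   | j , j<k , uw′ = rec j<k uw′

  walk-invariant : ∀ {A : Set} (f : Fin n → A) → (∀ a b → adj a b ≡ true → f a ≡ f b) →
    ∀ k {u w} → walk G k u w ≡ true → f u ≡ f w
  walk-invariant f edge zero    uw = cong f (walk-zero⇒≡ uw)
  walk-invariant f edge (suc k) uw with walk-uncons k uw
  ... | x , ux , xw = trans (edge _ x ux) (walk-invariant f edge k xw)

  search-skips : ∀ f i fuel {k} → i ≤ k → k < search G f i fuel → f k ≡ false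
  search-skips f i zero       i≤k k<i = contradiction i≤k (<⇒≱ k<i)
  search-skips f i (suc fuel) i≤k k<s with f i in fi
  ... | true  = contradiction i≤k (<⇒≱ k<s)
  ... | false with m≤n⇒m<n∨m≡n i≤k
  ...   | inj₁ i<k  = search-skips f (suc i) fuel i<k k<s
  ...   | inj₂ refl = fi

  search-hits⊎exhausts : ∀ f i fuel → f (search G f i fuel) ≡ true ⊎ search G f i fuel ≡ i + fuel
  search-hits⊎exhausts f i zero = inj₂ (sym (+-identityʳ i))
  search-hits⊎exhausts f i (suc fuel) with f i in fi
  ... | true  = inj₁ fi
  ... | false with search-hits⊎exhausts f (suc i) fuel
  ...   | inj₁ hit       = inj₁ hit
  ...   | inj₂ exhausted = inj₂ (trans exhausted (sym (+-suc i fuel)))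

  dist-minimal : ∀ k {u w} → walk G k u w ≡ true → dist G u w ≤ k
  dist-minimal k {u} {w} uw with k <? dist G u w
  ... | yes k<d = contradiction (trans (sym uw) (search-skips (λ k → walk G k u w) 0 n z≤n k<d)) λ ()
  ... | no  k≮d = ≮⇒≥ k≮d

  module _ (conn : Connected G) where

    dist-walk : ∀ u w → walk G (dist G u w) u w ≡ true
    dist-walk u w with walk-<n (proj₁ (conn u w)) (proj₂ (conn u w))
    ... | j , j<n , uw with search-hits⊎exhausts (λ k → walk G k u w) 0 n
    ...   | inj₁ hit       = hit
    ...   | inj₂ exhausted = contradiction exhausted (<⇒≢ (≤-trans (s≤s (dist-minimal j uw)) j<n))

    dist≡0⇒≡ : ∀ {u w} → dist G u w ≡ 0 → u ≡ w
    dist≡0⇒≡ {u} {w} d≡0 = walk-zero⇒≡ (subst (λ k → walk G k u w ≡ true) d≡0 (dist-walk u w))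

    dist≡1⇒adj : ∀ {u w} → dist G u w ≡ 1 → adj u w ≡ true
    dist≡1⇒adj {u} {w} d≡1 with walk-uncons 0 (subst (λ k → walk G k u w ≡ true) d≡1 (dist-walk u w))
    ... | x , ux , xw = subst (λ y → adj u y ≡ true) (walk-zero⇒≡ xw) ux

    ≟≡dist≡ᵇ0 : ∀ u w → ⌊ w ≟ u ⌋ ≡ (dist G u w ≡ᵇ 0)
    ≟≡dist≡ᵇ0 u w with w ≟ u | dist G u w in d
    ... | yes refl | zero  = refl
    ... | yes refl | suc _ = contradiction (subst (_≤ 0) d (dist-minimal 0 (walk-refl u))) λ ()
    ... | no w≢u   | zero  = contradiction (sym (dist≡0⇒≡ d)) w≢u
    ... | no _     | suc _ = refl

    adj≡dist≡ᵇ1 : ∀ u w → adj u w ≡ (dist G u w ≡ᵇ 1)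
    adj≡dist≡ᵇ1 u w with adj u w in uw | dist G u w in d
    ... | true  | zero        =
      contradiction (trans (sym uw) (subst (λ x → adj u x ≡ false) (dist≡0⇒≡ d) (adj-irr u))) λ ()
    ... | true  | suc zero    = refl
    ... | true  | suc (suc _) =
      contradiction (subst (_≤ 1) d (dist-minimal 1 (walk-∷ 0 uw (walk-refl w)))) λ { (s≤s ()) }
    ... | false | zero        = refl
    ... | false | suc zero    = contradiction (trans (sym (dist≡1⇒adj d)) uw) λ ()
    ... | false | suc (suc _) = refl

    dist-neighbour : ∀ {a b} w → adj a b ≡ true → dist G a w ≤ suc (dist G b w)
    dist-neighbour {a} {b} w ab = dist-minimal (suc (dist G b w)) (walk-∷ (dist G b w) ab (dist-walk b w))

even : ℕ → Bool
even zero    = true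
even (suc k) = not (even k)

neighbours-of-opposite-parity : ∀ {m n} → m ≤ suc n → n ≤ suc m → even m ≡ not (even n) →
  n ≡ suc m ⊎ m ≡ suc n
neighbours-of-opposite-parity {m} {n} m≤1+n n≤1+m parity with <-cmp m n
... | tri< m<n _ _ = inj₁ (≤-antisym n≤1+m m<n)
... | tri≈ _ refl _ = contradiction parity (not-¬ refl)
... | tri> _ _ n<m = inj₂ (≤-antisym m≤1+n n<m)

-- This is where the diameter bound enters: the identity fails for m = 3, n = 4.
distance-layers : ∀ m n → m ≤ 3 → n ≤ 3 → n ≡ suc m ⊎ m ≡ suc n →
  𝟙 (m <ᵇ n) + 𝟙 (n ≡ᵇ 1) + 𝟙 (n ≡ᵇ 0) ≡ 𝟙 (m ≡ᵇ 1) + 𝟙 (even m) + 𝟙 (m ≡ᵇ 0)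
distance-layers 0 _ _ _ (inj₁ refl) = refl
distance-layers 1 _ _ _ (inj₁ refl) = refl
distance-layers 2 _ _ _ (inj₁ refl) = refl
distance-layers 3 _ _ (s≤s (s≤s (s≤s ()))) (inj₁ refl)
distance-layers _ 0 _ _ (inj₂ refl) = refl
distance-layers _ 1 _ _ (inj₂ refl) = refl
distance-layers _ 2 _ _ (inj₂ refl) = refl
distance-layers _ 3 (s≤s (s≤s (s≤s ()))) _ (inj₂ refl)
distance-layers (suc (suc (suc (suc _)))) _ (s≤s (s≤s (s≤s ()))) _ _

private
  2*-+-cancelʳ : ∀ {a b c} → 2 * a + c ≡ 2 * b + c → a ≡ b
  2*-+-cancelʳ {a} {b} {c} eq = *-cancelˡ-≡ a b 2 (+-cancelʳ-≡ c (2 * a) (2 * b) eq)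

  cross-cancel : ∀ {x y a b} → a < b → x * a + y * b ≡ x * b + y * a → x ≡ y
  cross-cancel {x} {y} {a} a<b h with m≤n⇒∃[o]m+o≡n a<b
  ... | o , refl = sym (*-cancelʳ-≡ y x (suc o) (+-cancelʳ-≡ (x * a + y * a) _ _ (begin
    y * suc o + (x * a + y * a)  ≡⟨ solve (x ∷ y ∷ a ∷ o ∷ []) ⟩
    x * a + y * suc (a + o)      ≡⟨ h ⟩
    x * suc (a + o) + y * a      ≡⟨ solve (x ∷ y ∷ a ∷ o ∷ []) ⟩
    x * suc o + (x * a + y * a)  ∎)))
    where open ≡-Reasoning

x*a+y*b≡x*b+y*a⇒a≡b⊎x≡y : ∀ x y a b → x * a + y * b ≡ x * b + y * a → a ≡ b ⊎ x ≡ y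
x*a+y*b≡x*b+y*a⇒a≡b⊎x≡y x y a b h with <-cmp a b
... | tri< a<b _ _ = inj₂ (cross-cancel a<b h)
... | tri≈ _ a≡b _ = inj₁ a≡b
... | tri> _ _ b<a = inj₂ (cross-cancel b<a (sym h))

unequal-side-degrees : ∀ {A B P Q} → 2 * A + P ≡ 2 * B + Q → P * A ≡ Q * B → A ≢ B →
  2 * A ≡ Q × 2 * B ≡ P
unequal-side-degrees {A} {B} {P} {Q} balanced handshake A≢B
  with x*a+y*b≡x*b+y*a⇒a≡b⊎x≡y P (2 * B) A B (begin
    P * A + 2 * B * B  ≡⟨ cong (_+ 2 * B * B) handshake ⟩
    Q * B + 2 * B * B  ≡⟨ solve (B ∷ Q ∷ []) ⟩
    (2 * B + Q) * B    ≡⟨ cong (_* B) balanced ⟨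
    (2 * A + P) * B    ≡⟨ solve (A ∷ B ∷ P ∷ []) ⟩
    P * B + 2 * B * A  ∎)
  where open ≡-Reasoning
... | inj₁ A≡B = contradiction A≡B A≢B
... | inj₂ P≡2B =
  +-cancelʳ-≡ P (2 * A) Q (trans balanced (trans (cong (_+ Q) (sym P≡2B)) (+-comm P Q))) , sym P≡2B

module Sides {n : ℕ} (G : Graph n) (side : Fin n → Bool) where

  ∣X∣ ∣Y∣ : ℕ
  ∣X∣ = count G side
  ∣Y∣ = count G (λ w → not (side w))

  sideSize : Fin n → ℕ
  sideSize a = count G (λ w → ⌊ side w ≟ᵇ side a ⌋)

  potential : Fin n → ℕ
  potential a = 2 * deg G a + sideSize a

  potential-X : ∀ {u} → side u ≡ true → potential u ≡ 2 * deg G u + ∣X∣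
  potential-X {u} u∈X rewrite u∈X = cong (2 * deg G u +_) (count-cong G ≟true)
    where
    ≟true : ∀ w → ⌊ side w ≟ᵇ true ⌋ ≡ side w
    ≟true w with side w
    ... | true  = refl
    ... | false = refl

  potential-Y : ∀ {u} → side u ≡ false → potential u ≡ 2 * deg G u + ∣Y∣
  potential-Y {u} u∈Y rewrite u∈Y = cong (2 * deg G u +_) (count-cong G ≟false)
    where
    ≟false : ∀ w → ⌊ side w ≟ᵇ false ⌋ ≡ not (side w)
    ≟false w with side w
    ... | true  = refl
    ... | false = refl

  HalvingDegrees : Set
  HalvingDegrees = (∀ u → side u ≡ true → 2 * deg G u ≡ ∣Y∣) ×
                   (∀ v → side v ≡ false → 2 * deg G v ≡ ∣X∣)

  halving⇒potential≡ : HalvingDegrees → ∀ u → potential u ≡ ∣Y∣ + ∣X∣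
  halving⇒potential≡ (halfX , halfY) u = bool-cases (side u)
    (λ u∈X → trans (potential-X u∈X) (cong (_+ ∣X∣) (halfX u u∈X)))
    (λ u∈Y → trans (potential-Y u∈Y) (trans (cong (_+ ∣Y∣) (halfY u u∈Y)) (+-comm ∣X∣ ∣Y∣)))

module Bipartite {n : ℕ} (G : Graph n) (side : Fin n → Bool) (bip : IsBipartition G side) where
  open Graph G
  open Sides G side
  open ≡-Reasoning

  adjacent-sides : ∀ {u v} → adj u v ≡ true → side v ≡ not (side u)
  adjacent-sides {u} {v} uv = ¬-not (bip v u (trans (adj-sym v u) uv))

  same-side-flips : ∀ {a b} → adj a b ≡ true → ∀ t → ⌊ t ≟ᵇ side a ⌋ ≡ not ⌊ t ≟ᵇ side b ⌋
  same-side-flips {a} {b} ab t rewrite ¬-not (bip a b ab) with t | side b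
  ... | true  | true  = refl
  ... | true  | false = refl
  ... | false | true  = refl
  ... | false | false = refl

  walk-parity : ∀ k {a w} → walk G k a w ≡ true → ⌊ side w ≟ᵇ side a ⌋ ≡ even k
  walk-parity zero aw rewrite walk-zero⇒≡ G aw =
    trans (isYes≗does (side _ ≟ᵇ side _)) (dec-true (side _ ≟ᵇ side _) refl)
  walk-parity (suc k) {w = w} aw with walk-uncons G k aw
  ... | x , ax , xw = trans (same-side-flips ax (side w)) (cong not (walk-parity k xw))

  module _ (conn : Connected G) where

    dist-parity : ∀ a w → ⌊ side w ≟ᵇ side a ⌋ ≡ even (dist G a w)
    dist-parity a w = walk-parity (dist G a w) (dist-walk G conn a w)

    dist-adjacent : ∀ {a b} w → adj a b ≡ true →
      dist G b w ≡ suc (dist G a w) ⊎ dist G a w ≡ suc (dist G b w)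
    dist-adjacent {a} {b} w ab = neighbours-of-opposite-parity
      (dist-neighbour G conn w ab) (dist-neighbour G conn w (trans (adj-sym b a) ab)) (begin
        even (dist G a w)         ≡⟨ sym (dist-parity a w) ⟩
        ⌊ side w ≟ᵇ side a ⌋      ≡⟨ same-side-flips ab (side w) ⟩
        not ⌊ side w ≟ᵇ side b ⌋  ≡⟨ cong not (dist-parity b w) ⟩
        not (even (dist G b w))   ∎)

  private
    edge-from-X : ∀ u v → 𝟙 (side u) * 𝟙 (adj u v) ≡ 𝟙 (not (side v)) * 𝟙 (adj v u)
    edge-from-X u v rewrite adj-sym v u with adj u v in uv
    ... | false = trans (*-zeroʳ (𝟙 (side u))) (sym (*-zeroʳ (𝟙 (not (side v)))))
    ... | true rewrite adjacent-sides uv with side u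
    ...   | true  = refl
    ...   | false = refl

  -- Both sides count the edges of G.
  bipartite-handshake : ∑[ u < n ] (𝟙 (side u) * deg G u) ≡ ∑[ v < n ] (𝟙 (not (side v)) * deg G v)
  bipartite-handshake = begin
    ∑[ u < n ] (𝟙 (side u) * deg G u)
      ≡⟨ sum-cong-≗ (λ u → cong (𝟙 (side u) *_) (count≡∑ G (adj u))) ⟩
    ∑[ u < n ] (𝟙 (side u) * ∑[ v < n ] 𝟙 (adj u v))
      ≡⟨ sum-cong-≗ (λ u → *-distribˡ-sum (𝟙 (side u)) (λ v → 𝟙 (adj u v))) ⟩
    ∑[ u < n ] ∑[ v < n ] (𝟙 (side u) * 𝟙 (adj u v))
      ≡⟨ ∑-comm (λ u v → 𝟙 (side u) * 𝟙 (adj u v)) ⟩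
    ∑[ v < n ] ∑[ u < n ] (𝟙 (side u) * 𝟙 (adj u v))
      ≡⟨ sum-cong-≗ (λ v → sum-cong-≗ (λ u → edge-from-X u v)) ⟩
    ∑[ v < n ] ∑[ u < n ] (𝟙 (not (side v)) * 𝟙 (adj v u))
      ≡⟨ sum-cong-≗ (λ v → sym (*-distribˡ-sum (𝟙 (not (side v))) (λ u → 𝟙 (adj v u)))) ⟩
    ∑[ v < n ] (𝟙 (not (side v)) * ∑[ u < n ] 𝟙 (adj v u))
      ≡⟨ sum-cong-≗ (λ v → cong (𝟙 (not (side v)) *_) (sym (count≡∑ G (adj v)))) ⟩
    ∑[ v < n ] (𝟙 (not (side v)) * deg G v) ∎

  oriented-edge : ∀ {u v} → adj u v ≡ true →
    ∃[ x ] ∃[ y ] side x ≡ true × side y ≡ false × adj x y ≡ true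
  oriented-edge {u} {v} uv with side u in su
  ... | true  = u , v , su , trans (adjacent-sides uv) (cong not su) , uv
  ... | false = v , u , trans (adjacent-sides uv) (cong not su) , su , trans (adj-sym v u) uv

  handshake-with-side-degrees : ∀ {A B} → (∀ u → side u ≡ true → deg G u ≡ A) →
    (∀ v → side v ≡ false → deg G v ≡ B) →
    ∣X∣ * A ≡ ∣Y∣ * B
  handshake-with-side-degrees degX degY = begin
    ∣X∣ * _                                  ≡⟨ ∑-𝟙*-constant G degX ⟨
    ∑[ u < n ] (𝟙 (side u) * deg G u)        ≡⟨ bipartite-handshake ⟩
    ∑[ v < n ] (𝟙 (not (side v)) * deg G v)  ≡⟨ ∑-𝟙*-constant G (λ v v∈Y → degY v (not-injective v∈Y)) ⟩
    ∣Y∣ * _                                  ∎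

  module _ {x₀ y₀ : Fin n} (x₀∈X : side x₀ ≡ true) (y₀∈Y : side y₀ ≡ false)
           (x₀y₀ : adj x₀ y₀ ≡ true) where

    module _ (constant : ∀ u w → potential u ≡ potential w) where

      degree-on-X : ∀ u → side u ≡ true → deg G u ≡ deg G x₀
      degree-on-X u u∈X =
        2*-+-cancelʳ (trans (sym (potential-X u∈X)) (trans (constant u x₀) (potential-X x₀∈X)))

      degree-on-Y : ∀ v → side v ≡ false → deg G v ≡ deg G y₀
      degree-on-Y v v∈Y =
        2*-+-cancelʳ (trans (sym (potential-Y v∈Y)) (trans (constant v y₀) (potential-Y y₀∈Y)))

      two-degrees : ∀ u → deg G u ≡ deg G x₀ ⊎ deg G u ≡ deg G y₀
      two-degrees u = bool-cases (side u) (inj₁ ∘ degree-on-X u) (inj₂ ∘ degree-on-Y u)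

      balanced-sides : 2 * deg G x₀ + ∣X∣ ≡ 2 * deg G y₀ + ∣Y∣
      balanced-sides = trans (sym (potential-X x₀∈X)) (trans (constant x₀ y₀) (potential-Y y₀∈Y))

      constant-potential⇒regular⊎halving : Regular G ⊎ (Biregular G × HalvingDegrees)
      constant-potential⇒regular⊎halving with deg G x₀ ≟ℕ deg G y₀
      ... | yes A≡B = inj₁ (deg G x₀ , λ u → [ id , (λ degu≡B → trans degu≡B (sym A≡B)) ]′ (two-degrees u))
      ... | no  A≢B
        with unequal-side-degrees balanced-sides (handshake-with-side-degrees degree-on-X degree-on-Y) A≢B
      ...   | 2A≡∣Y∣ , 2B≡∣X∣ = inj₂
        ( (deg G x₀ , deg G y₀ , A≢B , two-degrees , (x₀ , refl) , (y₀ , refl))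
        , (λ u u∈X → trans (cong (2 *_) (degree-on-X u u∈X)) 2A≡∣Y∣)
        , (λ v v∈Y → trans (cong (2 *_) (degree-on-Y v v∈Y)) 2B≡∣X∣))

    regular⇒potential≡ : ∀ {k} → (∀ u → deg G u ≡ k) → ∀ u → potential u ≡ 2 * k + ∣X∣
    regular⇒potential≡ {k} deg≡k u = bool-cases (side u)
      (λ u∈X → trans (potential-X u∈X) (cong (λ d → 2 * d + ∣X∣) (deg≡k u)))
      (λ u∈Y → trans (potential-Y u∈Y) (cong₂ (λ d c → 2 * d + c) (deg≡k u) (sym X≡Y)))
      where
      k≢0 : NonZero k
      k≢0 = >-nonZero (subst (1 ≤_) (deg≡k x₀) (count-positive G y₀ x₀y₀))
      X≡Y : ∣X∣ ≡ ∣Y∣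
      X≡Y = *-cancelʳ-≡ _ _ k {{k≢0}} (handshake-with-side-degrees (λ u _ → deg≡k u) (λ v _ → deg≡k v))

    constant-potential⇔regular⊎halving :
      (∀ u w → potential u ≡ potential w) ⇔ (Regular G ⊎ (Biregular G × HalvingDegrees))
    constant-potential⇔regular⊎halving = mk⇔ constant-potential⇒regular⊎halving constant
      where
      constant : Regular G ⊎ (Biregular G × HalvingDegrees) → ∀ u w → potential u ≡ potential w
      constant (inj₁ (_ , deg≡k)) u w =
        trans (regular⇒potential≡ deg≡k u) (sym (regular⇒potential≡ deg≡k w))
      constant (inj₂ (_ , halving)) u w =
        trans (halving⇒potential≡ halving u) (sym (halving⇒potential≡ halving w))

module Diameter3 {n : ℕ} (G : Graph n) (side : Fin n → Bool)
                 (conn : Connected G) (diam : HasDiameter G 3) (bip : IsBipartition G side) where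
  open Graph G
  open Sides G side
  open Bipartite G side bip
  open ≡-Reasoning

  sizeW-pointwise : ∀ {a b} → adj a b ≡ true → ∀ w →
    𝟙 (dist G a w <ᵇ dist G b w) + 𝟙 (adj b w) + 𝟙 ⌊ w ≟ b ⌋ ≡
    𝟙 (adj a w) + 𝟙 ⌊ side w ≟ᵇ side a ⌋ + 𝟙 ⌊ w ≟ a ⌋
  sizeW-pointwise {a} {b} ab w
    rewrite adj≡dist≡ᵇ1 G conn a w | adj≡dist≡ᵇ1 G conn b w
          | ≟≡dist≡ᵇ0 G conn a w   | ≟≡dist≡ᵇ0 G conn b w
          | dist-parity conn a w
    = distance-layers (dist G a w) (dist G b w) (proj₁ diam a w) (proj₁ diam b w)
        (dist-adjacent conn w ab)

  sizeW-formula : ∀ {a b} → adj a b ≡ true → sizeW G a b + deg G b ≡ deg G a + sideSize a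
  sizeW-formula {a} {b} ab = +-cancelʳ-≡ 1 _ _ (begin
    sizeW G a b + deg G b + 1
      ≡⟨ cong (sizeW G a b + deg G b +_) (count-singleton G b) ⟨
    sizeW G a b + deg G b + count G (λ w → ⌊ w ≟ b ⌋)
      ≡⟨ count₃-cong G (sizeW-pointwise ab) ⟩
    deg G a + sideSize a + count G (λ w → ⌊ w ≟ a ⌋)
      ≡⟨ cong (deg G a + sideSize a +_) (count-singleton G a) ⟩
    deg G a + sideSize a + 1 ∎)

  potential≡sizeW : ∀ {a b} → adj a b ≡ true → potential a ≡ sizeW G a b + (deg G a + deg G b)
  potential≡sizeW {a} {b} ab = rearrange (deg G a) (deg G b) (sideSize a) (sizeW G a b) (sizeW-formula ab)
    where
    rearrange : ∀ x y s w → w + y ≡ x + s → 2 * x + s ≡ w + (x + y)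
    rearrange x y s w eq = begin
      2 * x + s        ≡⟨ solve (x ∷ s ∷ []) ⟩
      x + (x + s)      ≡⟨ cong (x +_) eq ⟨
      x + (w + y)      ≡⟨ solve (x ∷ w ∷ y ∷ []) ⟩
      w + (x + y)      ∎

  balanced-edge⇔constant-potential : ∀ {a b} → adj a b ≡ true →
    sizeW G a b ≡ sizeW G b a ⇔ potential a ≡ potential b
  balanced-edge⇔constant-potential {a} {b} ab = mk⇔
    (λ Wab≡Wba → trans φa (trans (cong (_+ c) Wab≡Wba) (sym φb)))
    (λ φa≡φb → +-cancelʳ-≡ c _ _ (trans (sym φa) (trans φa≡φb φb)))
    where
    c = deg G a + deg G b
    φa : potential a ≡ sizeW G a b + c
    φa = potential≡sizeW ab
    φb : potential b ≡ sizeW G b a + c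
    φb = trans (potential≡sizeW (trans (adj-sym b a) ab)) (cong (sizeW G b a +_) (+-comm (deg G b) (deg G a)))

  balanced⇔constant-potential : OneDistanceBalanced G ⇔ (∀ u w → potential u ≡ potential w)
  balanced⇔constant-potential = mk⇔
    (λ (_ , balanced) u w → walk-invariant G potential
      (λ a b ab → Equivalence.to (balanced-edge⇔constant-potential ab) (balanced a b ab))
      (proj₁ (conn u w)) (proj₂ (conn u w)))
    (λ constant → conn , λ a b ab → Equivalence.from (balanced-edge⇔constant-potential ab) (constant a b))

  has-edge : ∃[ u ] ∃[ v ] adj u v ≡ true
  has-edge with proj₂ diam
  ... | u , w , d≡3 with walk-uncons G 2 (subst (λ k → walk G k u w ≡ true) d≡3 (dist-walk G conn u w))
  ...   | v , uv , _ = u , v , uv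

proposition3p4 : {n : ℕ} (G : Graph n) (side : Fin n → Bool) →
    Connected G → HasDiameter G 3 → IsBipartition G side →
    OneDistanceBalanced G ⇔
      (Regular G ⊎
        (Biregular G ×
          (∀ u → side u ≡ true → 2 * deg G u ≡ count G (λ w → not (side w))) ×
          (∀ v → side v ≡ false → 2 * deg G v ≡ count G side)))
proposition3p4 G side conn diam bip with Diameter3.has-edge G side conn diam bip
... | _ , _ , uv with Bipartite.oriented-edge G side bip uv
...   | _ , _ , x₀∈X , y₀∈Y , x₀y₀ =
  Bipartite.constant-potential⇔regular⊎halving G side bip x₀∈X y₀∈Y x₀y₀
    ⇔-∘ Diameter3.balanced⇔constant-potential G side conn diam bip
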